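{- Let $n\ge1$ and let $\Gamma$, $v_0$ and $K$ be as in the context. The forward $K$-orbit $v_0,Kv_0,K^2v_0,\ldots$ is an enumeration without repetitions of all points of $\Gamma$ all of whose coordinates are dyadic rationals (elements of $\mathbb{Z}[1/2]$).
   Context: $\Gamma=\{(\alpha_1,\ldots,\alpha_n)\in\mathbb{R}^n:0\le\alpha_n\le\cdots\le\alpha_1\le1\}$. The tent map $T:\Gamma\to\Gamma$ is $T(\alpha_1,\ldots,\alpha_n)=(\alpha_1+\alpha_n,\alpha_1-\alpha_n,\alpha_2-\alpha_n,\ldots,\alpha_{n-1}-\alpha_n)$ if $\alpha_1+\alpha_n\le1$, and $(2-\alpha_1-\alpha_n,\alpha_1-\alpha_n,\ldots,\alpha_{n-1}-\alpha_n)$ if $\alpha_1+\alpha_n\ge1$. Its restrictions to $\Gamma\cap\{\alpha_1+\alpha_n\le1\}$ and $\Gamma\cap\{\alpha_1+\alpha_n\ge1\}$ are affine bijections onto $\Gamma$, with inverses $\tau_0,\tau_1$. $\Gamma^o=\{\alpha\in\Gamma:\alpha_1<1\}$, $v_0=(0,\ldots,0)$, $v_{ -1}$ the unique fixed point of $\tau_1$ in $\Gamma$. The sets $\{v_{ -1}\}$ and $\tau_1^k\tau_0\Gamma^o$ ($k\ge0$) partition $\Gamma$; $K:\Gamma\to\Gamma$ is defined by $Kv_{ -1}=v_0$ and $K=\tau_0^k\tau_1\circ(\tau_1^k\tau_0)^{ -1}$ on $\tau_1^k\tau_0\Gamma^o$. -}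

module Defs where

open import Data.Nat using (ℕ; zero; suc; _^_)
open import Data.Fin using (Fin; inject₁) renaming (suc to fsuc)
open import Data.Vec using (Vec; head; last; init; map; lookup; replicate; _∷_)
open import Data.Rational using (ℚ; _+_; _-_; _≤_; _<_; 0ℚ; 1ℚ)
open ℚ using (denominatorℕ)
open import Data.Product using (Σ; ∃; ∃-syntax; _×_; _,_)
open import Data.Sum using (_⊎_)
open import Relation.Binary.PropositionalEquality using (_≡_)

-- Points of ℝ^n with n = suc m ≥ 1 that have rational coordinates.
-- Index 0 is α₁, the last index is αₙ.
Pt : ℕ → Set
Pt m = Vec ℚ (suc m)

InΓ : ∀ {m} → Pt m → Set
InΓ {m} α = (0ℚ ≤ last α) × (head α ≤ 1ℚ)
          × (∀ (i : Fin m) → lookup α (fsuc i) ≤ lookup α (inject₁ i))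

InΓo : ∀ {m} → Pt m → Set
InΓo α = InΓ α × (head α < 1ℚ)

v0 : ∀ {m} → Pt m
v0 = replicate _ 0ℚ

-- the two affine branches of the tent map T
T0 : ∀ {m} → Pt m → Pt m
T0 α = (head α + last α) ∷ map (λ x → x - last α) (init α)

T1 : ∀ {m} → Pt m → Pt m
T1 α = ((1ℚ + 1ℚ) - head α - last α) ∷ map (λ x → x - last α) (init α)

-- Tau0 γ α  :⇔  α = τ₀ γ  (α ∈ Γ ∩ {α₁+αₙ ≤ 1} and T α = γ)
Tau0 : ∀ {m} → Pt m → Pt m → Set
Tau0 γ α = InΓ α × (head α + last α ≤ 1ℚ) × (T0 α ≡ γ)

-- Tau1 γ α  :⇔  α = τ₁ γ  (α ∈ Γ ∩ {α₁+αₙ ≥ 1} and T α = γ)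
Tau1 : ∀ {m} → Pt m → Pt m → Set
Tau1 γ α = InΓ α × (1ℚ ≤ head α + last α) × (T1 α ≡ γ)

Iter : ∀ {m} → (Pt m → Pt m → Set) → ℕ → Pt m → Pt m → Set
Iter R zero x y = x ≡ y
Iter R (suc k) x y = ∃[ z ] (Iter R k x z × R z y)

-- KRel α β  :⇔  β = K α
--   K v₋₁ = v₀ (v₋₁ the fixed point of τ₁ in Γ), and
--   K (τ₁^k τ₀ γ) = τ₀^k τ₁ γ for γ ∈ Γ^o.
KRel : ∀ {m} → Pt m → Pt m → Set
KRel α β =
  (Tau1 α α × β ≡ v0)
  ⊎ (∃[ k ] ∃[ γ ] (InΓo γ
       × (∃[ δ ] (Tau0 γ δ × Iter Tau1 k δ α))
       × (∃[ ε ] (Tau1 γ ε × Iter Tau0 k ε β))))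

Dyadic : ℚ → Set
Dyadic q = ∃[ k ] (denominatorℕ q ≡ 2 ^ k)

AllDyadic : ∀ {m} → Pt m → Set
AllDyadic α = ∀ i → Dyadic (lookup α i)

{-# OPTIONS --safe #-}
module Submission where

-- The inverse branches of T are τ₀ γ = lift γ₁ γ and τ₁ γ = lift (2 − γ₁) γ, where lift s γ is the
-- point α with α₁ + αₙ = s and (α₁ − αₙ, …, αₙ₋₁ − αₙ) = (γ₂, …, γₙ). List the tree spanned from v₀ by
-- τ₀ and τ₁ breadth first up to depth N. Since τ₀ v₀ = v₀, each list extends the previous one, and in
-- each list K maps every entry to the next one: the last child τ₁ α of a node α is followed by the
-- first child τ₀ β of the next node β, and K α = β gives K (τ₁ α) = τ₀ β. So the K-orbit of v₀ is the
-- limit of these lists. It has no repetitions because distinct points of Γ have disjoint sets of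
-- children, and it consists of dyadic points because τ₀ and τ₁ preserve them. Conversely, T drives
-- every dyadic point of Γ to v₀, which puts the point into the tree: if all coordinates lie in 2⁻ʲℤ,
-- then after n steps of T they lie in 2¹⁻ʲℤ, and the only even integer in [0, 1] is 0.

open import Defs
open import Data.Nat as ℕ using (ℕ; zero; suc; z≤n; s≤s; ≤′-refl; ≤′-step; _^_)
import Data.Nat.Properties as ℕ
open import Data.Nat.GeneralisedArithmetic using (iterate)
open import Data.Nat.Divisibility using (_∣_; divides; _∣?_; ∣1⇒≡1; *-cancelˡ-∣; m∣m*n)
import Data.Nat.Coprimality as Coprime
open import Data.Nat.Primality using (irreducible[2])
open import Data.Integer as ℤ using (ℤ; +_; +[1+_]; -[1+_]; +≤+; ∣_∣)
import Data.Integer.Properties as ℤ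
open import Data.Fin using (inject₁) renaming (zero to fzero; suc to fsuc)
open import Data.Rational
  using (ℚ; mkℚ; _/_; _+_; _-_; _*_; -_; _≤_; _<_; _≥_; *≤*; 0ℚ; 1ℚ; ½; ↥_; ↧_; ↧ₙ_; _≤?_; _<?_)
import Data.Rational.Properties as ℚ
import Data.Rational.Unnormalised.Base as ℚᵘ
import Data.Rational.Unnormalised.Properties as ℚᵘ
open import Data.Rational.Solver using (module +-*-Solver)
open +-*-Solver using (solve; _:+_; _:*_; _:-_; :-_; _:=_; con)
open import Data.Vec using (Vec; []; _∷_; head; tail; last; init; map; lookup; replicate; _∷ʳ_; initLast)
import Data.Vec.Properties as Vec
open import Data.Vec.Relation.Unary.All as All using (All; []; _∷_)
import Data.Vec.Relation.Unary.All.Properties as All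
import Data.Vec.Relation.Unary.Linked as VecLinked
open VecLinked using ([-]; _∷_)
import Data.Vec.Relation.Unary.Linked.Properties as VecLinked
open import Data.List using (List; []; _∷_; _++_; length; concatMap; concat)
import Data.List as List
open import Data.List.Properties using (++-assoc; ++-identityʳ; length-++; concat-++; map-++)
open import Data.List.Membership.Propositional using (_∈_; find; lose)
open import Data.List.Membership.Propositional.Properties using (∈-concatMap⁻; ∈-concatMap⁺)
open import Data.List.Relation.Unary.Any using (here; there)
open import Data.List.Relation.Unary.All as ListAll using ([]; _∷_)
import Data.List.Relation.Unary.All.Properties as ListAll
open import Data.List.Relation.Unary.Linked using (Linked; []; [-]; _∷_)
open import Data.List.Relation.Unary.Unique.Propositional using (Unique)
import Data.List.Relation.Unary.Unique.Propositional.Properties as Unique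
open import Data.List.Relation.Unary.AllPairs using ([]; _∷_)
open import Data.Product using (Σ; ∃-syntax; _×_; _,_; proj₁; proj₂)
open import Data.Sum using (_⊎_; inj₁; inj₂)
open import Data.Unit using (⊤; tt)
open import Data.Empty using (⊥; ⊥-elim)
open import Function using (_∘_)
open import Relation.Binary.Core using (Rel)
open import Relation.Nullary using (¬_; yes; no)
open import Relation.Binary.PropositionalEquality
  using (_≡_; _≢_; refl; sym; trans; cong; cong₂; subst; subst₂; module ≡-Reasoning)

private
  variable
    m n : ℕ
    A B : Set
    P : A → Set

module _ {a} {A : Set a} (default : A) where

  nth : List A → ℕ → A
  nth []       _       = default
  nth (x ∷ xs) zero    = x
  nth (x ∷ xs) (suc i) = nth xs i

  nth-++ˡ : ∀ xs ys {i} → i ℕ.< length xs → nth (xs ++ ys) i ≡ nth xs i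
  nth-++ˡ (x ∷ xs) ys {zero}  _         = refl
  nth-++ˡ (x ∷ xs) ys {suc i} (s≤s i<n) = nth-++ˡ xs ys i<n

  nth-∈ : ∀ xs {i} → i ℕ.< length xs → nth xs i ∈ xs
  nth-∈ (x ∷ xs) {zero}  _         = here refl
  nth-∈ (x ∷ xs) {suc i} (s≤s i<n) = there (nth-∈ xs i<n)

  ∈⇒nth : ∀ {x xs} → x ∈ xs → ∃[ i ] (i ℕ.< length xs × nth xs i ≡ x)
  ∈⇒nth (here refl) = zero , s≤s z≤n , refl
  ∈⇒nth (there x∈xs) with ∈⇒nth x∈xs
  ... | i , i<n , eq = suc i , s≤s i<n , eq

  nth-injective : ∀ {xs} → Unique xs → ∀ {i j} → i ℕ.< length xs → j ℕ.< length xs →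
                  nth xs i ≡ nth xs j → i ≡ j
  nth-injective (_ ∷ _) {zero} {zero} _ _ _ = refl
  nth-injective {x ∷ xs} (x∉xs ∷ _) {zero} {suc j} _ (s≤s j<n) eq =
    ⊥-elim (ListAll.lookup x∉xs (nth-∈ xs j<n) eq)
  nth-injective {x ∷ xs} (x∉xs ∷ _) {suc i} {zero} (s≤s i<n) _ eq =
    ⊥-elim (ListAll.lookup x∉xs (nth-∈ xs i<n) (sym eq))
  nth-injective (_ ∷ u) {suc i} {suc j} (s≤s i<n) (s≤s j<n) eq =
    cong suc (nth-injective u i<n j<n eq)

  nth-linked : ∀ {r} {R : Rel A r} {xs} → Linked R xs → ∀ {i} → suc i ℕ.< length xs →
               R (nth xs i) (nth xs (suc i))
  nth-linked [-]      (s≤s ())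
  nth-linked (r ∷ _)  {zero}  _         = r
  nth-linked (_ ∷ rs) {suc i} (s≤s i<n) = nth-linked rs i<n

  module Limit (L : ℕ → List A)
               (nonempty : 0 ℕ.< length (L 0))
               (grows : ∀ N → ∃[ x ] ∃[ xs ] (L (suc N) ≡ L N ++ x ∷ xs)) where

    limit : ℕ → A
    limit j = nth (L j) j

    N<length : ∀ N → N ℕ.< length (L N)
    N<length zero    = nonempty
    N<length (suc N) with grows N
    ... | x , xs , eq = subst (λ ys → suc N ℕ.< length ys) (sym eq)
      (subst (suc N ℕ.<_) (sym (length-++ (L N)))
        (ℕ.≤-trans (s≤s (N<length N)) (ℕ.m<m+n (length (L N)) (s≤s z≤n))))

    prefix : ∀ {N M} → N ℕ.≤′ M → ∃[ xs ] (L M ≡ L N ++ xs)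
    prefix {N} ≤′-refl = [] , sym (++-identityʳ (L N))
    prefix {N} (≤′-step N≤M) with prefix N≤M | grows _
    ... | xs , eq | y , ys′ , eq′ = let ys = y ∷ ys′ in
      xs ++ ys , trans eq′ (trans (cong (_++ ys) eq) (++-assoc (L N) xs ys))

    ≤⇒<length : ∀ {i N} → i ℕ.≤ N → i ℕ.< length (L N)
    ≤⇒<length {i} {N} i≤N with prefix (ℕ.≤⇒≤′ i≤N)
    ... | xs , eq = subst (λ ys → i ℕ.< length ys) (sym eq)
      (subst (i ℕ.<_) (sym (length-++ (L i))) (ℕ.<-≤-trans (N<length i) (ℕ.m≤m+n _ _)))

    nth-stable : ∀ {N M i} → N ℕ.≤ M → i ℕ.< length (L N) → nth (L M) i ≡ nth (L N) i
    nth-stable {N} N≤M i<n with prefix (ℕ.≤⇒≤′ N≤M)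
    ... | xs , eq = trans (cong (λ ys → nth ys _) eq) (nth-++ˡ (L N) xs i<n)

    limit-nth : ∀ {N i} → i ℕ.< length (L N) → limit i ≡ nth (L N) i
    limit-nth {N} {i} i<n with ℕ.≤-total i N
    ... | inj₁ i≤N = sym (nth-stable i≤N (N<length i))
    ... | inj₂ N≤i = nth-stable N≤i i<n

    limit-injective : (∀ N → Unique (L N)) → ∀ i j → limit i ≡ limit j → i ≡ j
    limit-injective unique i j eq =
      nth-injective (unique N) i<n j<n
        (trans (sym (limit-nth i<n)) (trans eq (limit-nth j<n)))
      where
      N = i ℕ.+ j
      i<n = ≤⇒<length (ℕ.m≤m+n i j)
      j<n = ≤⇒<length (ℕ.m≤n+m j i)

    limit-linked : ∀ {r} {R : Rel A r} → (∀ N → Linked R (L N)) → ∀ j → R (limit j) (limit (suc j))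
    limit-linked {R = R} linked j =
      subst₂ R (sym (limit-nth j<n)) (sym (limit-nth sj<n)) (nth-linked (linked (suc j)) sj<n)
      where
      j<n  = ≤⇒<length (ℕ.n≤1+n j)
      sj<n = N<length (suc j)

    limit-all : ∀ {p} {P : A → Set p} → (∀ N → ListAll.All P (L N)) → ∀ j → P (limit j)
    limit-all all j = ListAll.lookup (all j) (nth-∈ (L j) (N<length j))

    limit-surjective : ∀ {x N} → x ∈ L N → ∃[ j ] (limit j ≡ x)
    limit-surjective x∈L with ∈⇒nth x∈L
    ... | i , i<n , eq = i , trans (limit-nth i<n) eq

concatMap-++ : ∀ (f : A → List B) xs ys →
               concatMap f (xs ++ ys) ≡ concatMap f xs ++ concatMap f ys
concatMap-++ f xs ys =
  trans (cong concat (map-++ f xs ys)) (sym (concat-++ (List.map f xs) (List.map f ys)))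

iterate-+ : ∀ (f : A → A) x a b → iterate f x (a ℕ.+ b) ≡ iterate f (iterate f x a) b
iterate-+ f x zero    b = refl
iterate-+ f x (suc a) b = iterate-+ f (f x) a b

head-map : ∀ (f : A → B) (v : Vec A (suc n)) → head (map f v) ≡ f (head v)
head-map f (x ∷ v) = refl

last-map : ∀ (f : A → B) (v : Vec A (suc n)) → last (map f v) ≡ f (last v)
last-map f (x ∷ [])    = refl
last-map f (x ∷ y ∷ v) = last-map f (y ∷ v)

init-map : ∀ (f : A → B) (v : Vec A (suc n)) → init (map f v) ≡ map f (init v)
init-map f (x ∷ [])    = refl
init-map f (x ∷ y ∷ v) = cong (f x ∷_) (init-map f (y ∷ v))

last-replicate : ∀ n (x : A) → last (replicate (suc n) x) ≡ x
last-replicate zero    x = refl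
last-replicate (suc n) x = last-replicate n x

init-replicate : ∀ n (x : A) → init (replicate (suc n) x) ≡ replicate n x
init-replicate zero    x = refl
init-replicate (suc n) x = cong (x ∷_) (init-replicate n x)

all-head : ∀ {v : Vec A (suc n)} → All P v → P (head v)
all-head (p ∷ _) = p

all-last : ∀ {v : Vec A (suc n)} → All P v → P (last v)
all-last {v = x ∷ []}    (p ∷ [])  = p
all-last {v = x ∷ y ∷ v} (_ ∷ ps) = all-last ps

all-init : ∀ {v : Vec A (suc n)} → All P v → All P (init v)
all-init {v = x ∷ []}    _        = []
all-init {v = x ∷ y ∷ v} (p ∷ ps) = p ∷ all-init ps

all-∷ʳ : ∀ {v : Vec A n} {x} → All P v → P x → All P (v ∷ʳ x)
all-∷ʳ []       px = px ∷ []
all-∷ʳ (p ∷ ps) px = p ∷ all-∷ʳ ps px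

two : ℚ
two = 1ℚ + 1ℚ

0≤1 : 0ℚ ≤ 1ℚ
0≤1 = ℚ.<⇒≤ (ℚ.positive⁻¹ 1ℚ)

p≤q⇒0≤q-p : ∀ {p q} → p ≤ q → 0ℚ ≤ q - p
p≤q⇒0≤q-p {p} {q} p≤q = subst (_≤ q - p) (ℚ.+-inverseʳ p) (ℚ.+-monoˡ-≤ (- p) p≤q)

≤-by-difference : ∀ {p q e} → 0ℚ ≤ e → q - p ≡ e → p ≤ q
≤-by-difference {p} {q} 0≤e eq =
  subst₂ _≤_ (ℚ.+-identityˡ p) (trans (cong (_+ p) (sym eq)) (cancel q p)) (ℚ.+-monoˡ-≤ p 0≤e)
  where
  cancel : ∀ q p → q - p + p ≡ q
  cancel = solve 2 (λ q p → q :- p :+ p := q) refl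

0≤p⇒0≤½*p : ∀ {p} → 0ℚ ≤ p → 0ℚ ≤ ½ * p
0≤p⇒0≤½*p = ℚ.*-monoˡ-≤-nonNeg ½

p≤1⇒1≤two-p : ∀ {p} → p ≤ 1ℚ → 1ℚ ≤ two - p
p≤1⇒1≤two-p {p} p≤1 = ≤-by-difference (p≤q⇒0≤q-p p≤1) (gap p)
  where
  gap : ∀ p → (two - p) - 1ℚ ≡ 1ℚ - p
  gap = solve 1 (λ p → ((con 1ℚ :+ con 1ℚ) :- p) :- con 1ℚ := con 1ℚ :- p) refl

two-[two-p]≡p : ∀ p → two - (two - p) ≡ p
two-[two-p]≡p = solve 1 (λ p → (con 1ℚ :+ con 1ℚ) :- ((con 1ℚ :+ con 1ℚ) :- p) := p) refl

-- The inverse branches τ₀ and τ₁ of the tent map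

shift : Pt m → Pt m
shift γ = tail γ ∷ʳ 0ℚ

offset : ℚ → Pt m → ℚ
offset s γ = ½ * (s - head (shift γ))

lift : ℚ → Pt m → Pt m
lift s γ = map (_+ offset s γ) (shift γ)

τ₀ : Pt m → Pt m
τ₀ γ = lift (head γ) γ

τ₁ : Pt m → Pt m
τ₁ γ = lift (two - head γ) γ

T-tail : Pt m → Vec ℚ m
T-tail α = map (_- last α) (init α)

last-lift : ∀ s (γ : Pt m) → last (lift s γ) ≡ 0ℚ + offset s γ
last-lift s γ = trans (last-map _ (shift γ)) (cong (_+ offset s γ) (Vec.last-∷ʳ 0ℚ (tail γ)))

head+last-lift : ∀ s (γ : Pt m) → head (lift s γ) + last (lift s γ) ≡ s
head+last-lift s γ =
  trans (cong₂ _+_ (head-map _ (shift γ)) (last-lift s γ)) (halves (head (shift γ)) s)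
  where
  halves : ∀ h s → h + ½ * (s - h) + (0ℚ + ½ * (s - h)) ≡ s
  halves = solve 2 (λ h s → h :+ con ½ :* (s :- h) :+ (con 0ℚ :+ con ½ :* (s :- h)) := s) refl

T-tail-lift : ∀ s (γ : Pt m) → T-tail (lift s γ) ≡ tail γ
T-tail-lift s γ = begin
  map (_- last (lift s γ)) (init (lift s γ))
    ≡⟨ cong₂ (λ l v → map (_- l) v) (last-lift s γ)
             (trans (init-map _ (shift γ)) (cong (map _) (Vec.init-∷ʳ 0ℚ (tail γ)))) ⟩
  map (_- (0ℚ + c)) (map (_+ c) (tail γ))
    ≡⟨ Vec.map-∘ _ _ (tail γ) ⟨
  map (λ x → (x + c) - (0ℚ + c)) (tail γ)
    ≡⟨ Vec.map-cong (λ x → cancel x c) (tail γ) ⟩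
  map (λ x → x) (tail γ)
    ≡⟨ Vec.map-id (tail γ) ⟩
  tail γ ∎
  where
  open ≡-Reasoning
  c = offset s γ
  cancel : ∀ x c → (x + c) - (0ℚ + c) ≡ x
  cancel = solve 2 (λ x c → (x :+ c) :- (con 0ℚ :+ c) := x) refl

T0-τ₀ : ∀ (γ : Pt m) → T0 (τ₀ γ) ≡ γ
T0-τ₀ (x ∷ v) = cong₂ _∷_ (head+last-lift x (x ∷ v)) (T-tail-lift x (x ∷ v))

T1-τ₁ : ∀ (γ : Pt m) → T1 (τ₁ γ) ≡ γ
T1-τ₁ (x ∷ v) = cong₂ _∷_ first (T-tail-lift (two - x) (x ∷ v))
  where
  α = τ₁ (x ∷ v)
  reflect : ∀ h l x → h + l ≡ two - x → two - h - l ≡ x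
  reflect h l x eq = trans (regroup h l) (trans (cong (λ z → two - z) eq) (two-[two-p]≡p x))
    where
    regroup : ∀ h l → two - h - l ≡ two - (h + l)
    regroup = solve 2 (λ h l → (con 1ℚ :+ con 1ℚ) :- h :- l := (con 1ℚ :+ con 1ℚ) :- (h :+ l)) refl
  first : two - head α - last α ≡ x
  first = reflect (head α) (last α) x (head+last-lift (two - x) (x ∷ v))

head-shift-T-tail : ∀ x (α : Pt m) → head (shift (x ∷ T-tail α)) ≡ head α - last α
head-shift-T-tail x (a ∷ [])     = sym (ℚ.+-inverseʳ a)
head-shift-T-tail x (a ∷ b ∷ v) = refl

shift-T-tail : ∀ x (α : Pt m) → map (_+ last α) (shift (x ∷ T-tail α)) ≡ α
shift-T-tail x α = begin
  map (_+ l) (T-tail α ∷ʳ 0ℚ)          ≡⟨ Vec.map-∷ʳ _ 0ℚ (T-tail α) ⟩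
  map (_+ l) (T-tail α) ∷ʳ (0ℚ + l)    ≡⟨ cong₂ _∷ʳ_ restore (ℚ.+-identityˡ l) ⟩
  init α ∷ʳ l                           ≡⟨ proj₂ (proj₂ (initLast α)) ⟨
  α                                     ∎
  where
  open ≡-Reasoning
  l = last α
  cancel : ∀ x l → (x - l) + l ≡ x
  cancel = solve 2 (λ x l → (x :- l) :+ l := x) refl
  restore : map (_+ l) (T-tail α) ≡ init α
  restore = trans (sym (Vec.map-∘ _ _ (init α)))
              (trans (Vec.map-cong (λ x → cancel x l) (init α)) (Vec.map-id (init α)))

lift-T-tail : ∀ (α : Pt m) s x → s ≡ head α + last α → lift s (x ∷ T-tail α) ≡ α
lift-T-tail α s x eq =
  trans (cong (λ c → map (_+ c) (shift (x ∷ T-tail α))) offset≡last) (shift-T-tail x α)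
  where
  half-gap : ∀ h l → ½ * ((h + l) - (h - l)) ≡ l
  half-gap = solve 2 (λ h l → con ½ :* ((h :+ l) :- (h :- l)) := l) refl
  offset≡last : offset s (x ∷ T-tail α) ≡ last α
  offset≡last = trans (cong₂ (λ s h → ½ * (s - h)) eq (head-shift-T-tail x α))
                      (half-gap (head α) (last α))

τ₀-T0 : ∀ (α : Pt m) → τ₀ (T0 α) ≡ α
τ₀-T0 α = lift-T-tail α (head α + last α) (head α + last α) refl

τ₁-T1 : ∀ (α : Pt m) → τ₁ (T1 α) ≡ α
τ₁-T1 α = lift-T-tail α (two - t) t (reflect two (head α) (last α))
  where
  t = two - head α - last α
  reflect : ∀ t h l → t - (t - h - l) ≡ h + l
  reflect = solve 3 (λ t h l → t :- (t :- h :- l) := h :+ l) refl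

τ₀≡τ₁ : ∀ (γ : Pt m) → head γ ≡ 1ℚ → τ₀ γ ≡ τ₁ γ
τ₀≡τ₁ γ h≡1 = cong (λ s → lift s γ) (trans h≡1 (sym (cong (λ h → two - h) h≡1)))

τ₀-injective : ∀ {β β′ : Pt m} → τ₀ β ≡ τ₀ β′ → β ≡ β′
τ₀-injective {β = β} {β′} eq = trans (sym (T0-τ₀ β)) (trans (cong T0 eq) (T0-τ₀ β′))

τ₁-injective : ∀ {β β′ : Pt m} → τ₁ β ≡ τ₁ β′ → β ≡ β′
τ₁-injective {β = β} {β′} eq = trans (sym (T1-τ₁ β)) (trans (cong T1 eq) (T1-τ₁ β′))

T : Pt m → Pt m
T α with head α + last α ≤? 1ℚ
... | yes _ = T0 α
... | no  _ = T1 α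

T-section : ∀ (α : Pt m) → α ≡ τ₀ (T α) ⊎ α ≡ τ₁ (T α)
T-section α with head α + last α ≤? 1ℚ
... | yes _ = inj₁ (sym (τ₀-T0 α))
... | no  _ = inj₂ (sym (τ₁-T1 α))

T0-v0 : T0 (v0 {m}) ≡ v0
T0-v0 {m} = cong₂ _∷_ (cong (λ l → 0ℚ + l) (last-replicate m 0ℚ))
  (trans (cong₂ (λ l v → map (_- l) v) (last-replicate m 0ℚ) (init-replicate m 0ℚ))
         (Vec.map-replicate _ 0ℚ m))

τ₀-v0 : τ₀ (v0 {m}) ≡ v0
τ₀-v0 = trans (cong τ₀ (sym T0-v0)) (τ₀-T0 v0)

-- The simplex Γ

Descending : Vec ℚ n → Set
Descending = VecLinked.Linked _≥_

record InΓ′ (α : Pt m) : Set where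
  constructor mkΓ
  field
    last-nonneg : 0ℚ ≤ last α
    head≤1      : head α ≤ 1ℚ
    descending  : Descending α
open InΓ′

descending⇒lookup : ∀ (v : Pt m) → Descending v → ∀ i → lookup v (fsuc i) ≤ lookup v (inject₁ i)
descending⇒lookup (x ∷ y ∷ v) (y≤x ∷ _) fzero    = y≤x
descending⇒lookup (x ∷ y ∷ v) (_ ∷ d)   (fsuc i) = descending⇒lookup (y ∷ v) d i

lookup⇒descending : ∀ (v : Pt m) → (∀ i → lookup v (fsuc i) ≤ lookup v (inject₁ i)) → Descending v
lookup⇒descending (x ∷ [])    _   = [-]
lookup⇒descending (x ∷ y ∷ v) mon = mon fzero ∷ lookup⇒descending (y ∷ v) (mon ∘ fsuc)

InΓ⇒InΓ′ : ∀ {α : Pt m} → InΓ α → InΓ′ α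
InΓ⇒InΓ′ {α = α} (l≥0 , h≤1 , mon) = mkΓ l≥0 h≤1 (lookup⇒descending α mon)

InΓ′⇒InΓ : ∀ {α : Pt m} → InΓ′ α → InΓ α
InΓ′⇒InΓ {α = α} (mkΓ l≥0 h≤1 d) = l≥0 , h≤1 , descending⇒lookup α d

last≤head : ∀ (v : Vec ℚ (suc n)) → Descending v → last v ≤ head v
last≤head (x ∷ [])    _         = ℚ.≤-refl
last≤head (x ∷ y ∷ v) (y≤x ∷ d) = ℚ.≤-trans (last≤head (y ∷ v) d) y≤x

descending-∷ʳ : ∀ (v : Vec ℚ (suc n)) {x} → Descending v → x ≤ last v → Descending (v ∷ʳ x)
descending-∷ʳ (y ∷ [])    _         x≤y = x≤y ∷ [-]
descending-∷ʳ (y ∷ z ∷ v) (z≤y ∷ d) x≤l = z≤y ∷ descending-∷ʳ (z ∷ v) d x≤l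

descending-init : ∀ (v : Vec ℚ (suc n)) → Descending v → Descending (init v)
descending-init (x ∷ [])        _         = VecLinked.[]
descending-init (x ∷ y ∷ [])    _         = [-]
descending-init (x ∷ y ∷ z ∷ v) (y≤x ∷ d) = y≤x ∷ descending-init (y ∷ z ∷ v) d

last≤last-init : ∀ (v : Vec ℚ (suc (suc n))) → Descending v → last v ≤ last (init v)
last≤last-init (x ∷ y ∷ [])    (y≤x ∷ _) = y≤x
last≤last-init (x ∷ y ∷ z ∷ v) (_ ∷ d)   = last≤last-init (y ∷ z ∷ v) d

descending-map : ∀ (f : ℚ → ℚ) → (∀ {x y} → y ≤ x → f y ≤ f x) →
                 ∀ {v : Vec ℚ n} → Descending v → Descending (map f v)
descending-map f mono d = VecLinked.map⁺ (VecLinked.map mono d)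

InΓ′-bounded : ∀ {α : Pt m} → InΓ′ α → All (λ x → 0ℚ ≤ x × x ≤ 1ℚ) α
InΓ′-bounded (mkΓ l≥0 h≤1 d) = go _ d l≥0 h≤1
  where
  go : ∀ {n} (v : Vec ℚ (suc n)) → Descending v → 0ℚ ≤ last v → head v ≤ 1ℚ → All (λ x → 0ℚ ≤ x × x ≤ 1ℚ) v
  go (x ∷ [])    _          l≥0 x≤1 = (l≥0 , x≤1) ∷ []
  go (x ∷ y ∷ v) d@(y≤x ∷ d′) l≥0 x≤1 =
    (ℚ.≤-trans l≥0 (last≤head (x ∷ y ∷ v) d) , x≤1) ∷ go (y ∷ v) d′ l≥0 (ℚ.≤-trans y≤x x≤1)

v0-InΓ′ : InΓ′ (v0 {m})
v0-InΓ′ {m} = mkΓ (ℚ.≤-reflexive (sym (last-replicate m 0ℚ))) 0≤1 (constant (suc m))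
  where
  constant : ∀ n → Descending (replicate n 0ℚ)
  constant zero          = VecLinked.[]
  constant (suc zero)    = [-]
  constant (suc (suc n)) = ℚ.≤-refl ∷ constant (suc n)

shift-descending : ∀ {γ : Pt m} → InΓ′ γ → Descending (shift γ)
shift-descending {γ = x ∷ []}    _                   = [-]
shift-descending {γ = x ∷ y ∷ v} (mkΓ l≥0 _ (_ ∷ d)) = descending-∷ʳ (y ∷ v) d l≥0

head-shift≤head : ∀ {γ : Pt m} → InΓ′ γ → head (shift γ) ≤ head γ
head-shift≤head {γ = x ∷ []}    g                   = last-nonneg g
head-shift≤head {γ = x ∷ y ∷ v} (mkΓ _ _ (y≤x ∷ _)) = y≤x

lift-InΓ′ : ∀ {γ : Pt m} s → InΓ′ γ → head (shift γ) ≤ s → head (shift γ) ≤ two - s → InΓ′ (lift s γ)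
lift-InΓ′ {γ = γ} s g h≤s h≤2-s = mkΓ
  (subst (0ℚ ≤_) (sym (trans (last-lift s γ) (ℚ.+-identityˡ _))) (0≤p⇒0≤½*p (p≤q⇒0≤q-p h≤s)))
  (subst (_≤ 1ℚ) (sym (head-map _ (shift γ)))
    (≤-by-difference (0≤p⇒0≤½*p (p≤q⇒0≤q-p h≤2-s)) (gap (head (shift γ)) s)))
  (descending-map _ (ℚ.+-monoˡ-≤ (offset s γ)) (shift-descending g))
  where
  gap : ∀ h s → 1ℚ - (h + ½ * (s - h)) ≡ ½ * ((two - s) - h)
  gap = solve 2 (λ h s → con 1ℚ :- (h :+ con ½ :* (s :- h))
                         := con ½ :* (((con 1ℚ :+ con 1ℚ) :- s) :- h)) refl

τ₀-InΓ′ : ∀ {γ : Pt m} → InΓ′ γ → InΓ′ (τ₀ γ)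
τ₀-InΓ′ g = lift-InΓ′ _ g (head-shift≤head g)
  (ℚ.≤-trans (ℚ.≤-trans (head-shift≤head g) (head≤1 g)) (p≤1⇒1≤two-p (head≤1 g)))

τ₁-InΓ′ : ∀ {γ : Pt m} → InΓ′ γ → InΓ′ (τ₁ γ)
τ₁-InΓ′ {γ = γ} g = lift-InΓ′ _ g
  (ℚ.≤-trans (ℚ.≤-trans (head-shift≤head g) (head≤1 g)) (p≤1⇒1≤two-p (head≤1 g)))
  (subst (head (shift γ) ≤_) (sym (two-[two-p]≡p (head γ))) (head-shift≤head g))

Tau0-τ₀ : ∀ {γ : Pt m} → InΓ′ γ → Tau0 γ (τ₀ γ)
Tau0-τ₀ {γ = γ} g =
  InΓ′⇒InΓ (τ₀-InΓ′ g) , subst (_≤ 1ℚ) (sym (head+last-lift _ γ)) (head≤1 g) , T0-τ₀ γ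

Tau1-τ₁ : ∀ {γ : Pt m} → InΓ′ γ → Tau1 γ (τ₁ γ)
Tau1-τ₁ {γ = γ} g =
  InΓ′⇒InΓ (τ₁-InΓ′ g) , subst (1ℚ ≤_) (sym (head+last-lift _ γ)) (p≤1⇒1≤two-p (head≤1 g)) , T1-τ₁ γ

τ₀≡τ₁⇒ : ∀ {β β′ : Pt m} → InΓ′ β → InΓ′ β′ → τ₀ β ≡ τ₁ β′ → β ≡ β′ × head β ≡ 1ℚ
τ₀≡τ₁⇒ {β = b ∷ v} {b′ ∷ v′} g g′ eq = cong₂ _∷_ (trans b≡1 (sym b′≡1)) v≡v′ , b≡1
  where
  b≡2-b′ : b ≡ two - b′
  b≡2-b′ = trans (sym (head+last-lift b (b ∷ v)))
             (trans (cong (λ α → head α + last α) eq) (head+last-lift (two - b′) (b′ ∷ v′)))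
  b≡1 : b ≡ 1ℚ
  b≡1 = ℚ.≤-antisym (head≤1 g) (subst (1ℚ ≤_) (sym b≡2-b′) (p≤1⇒1≤two-p (head≤1 g′)))
  b′≡1 : b′ ≡ 1ℚ
  b′≡1 = trans (sym (two-[two-p]≡p b′)) (cong (λ x → two - x) (trans (sym b≡2-b′) b≡1))
  v≡v′ : v ≡ v′
  v≡v′ = trans (sym (T-tail-lift b (b ∷ v))) (trans (cong T-tail eq) (T-tail-lift (two - b′) (b′ ∷ v′)))

∷-T-tail-InΓ′ : ∀ {α : Pt m} s → InΓ′ α → 0ℚ ≤ s → s ≤ 1ℚ → head α - last α ≤ s →
                InΓ′ (s ∷ T-tail α)
∷-T-tail-InΓ′ {α = a ∷ []}    s _ 0≤s s≤1 _ = mkΓ 0≤s s≤1 [-]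
∷-T-tail-InΓ′ {α = a ∷ b ∷ v} s (mkΓ _ _ d) 0≤s s≤1 h-l≤s = mkΓ
  (subst (0ℚ ≤_) (sym (last-map _ (init (a ∷ b ∷ v)))) (p≤q⇒0≤q-p (last≤last-init (a ∷ b ∷ v) d)))
  s≤1
  (h-l≤s ∷ descending-map _ (ℚ.+-monoˡ-≤ (- last (b ∷ v))) (descending-init (a ∷ b ∷ v) d))

T0-InΓ′ : ∀ {α : Pt m} → InΓ′ α → head α + last α ≤ 1ℚ → InΓ′ (T0 α)
T0-InΓ′ {α = α} g h+l≤1 = ∷-T-tail-InΓ′ _ g
  (ℚ.+-mono-≤ (ℚ.≤-trans (last-nonneg g) (last≤head α (descending g))) (last-nonneg g))
  h+l≤1
  (≤-by-difference (ℚ.+-mono-≤ (last-nonneg g) (last-nonneg g)) (gap (head α) (last α)))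
  where
  gap : ∀ h l → (h + l) - (h - l) ≡ l + l
  gap = solve 2 (λ h l → (h :+ l) :- (h :- l) := l :+ l) refl

T1-InΓ′ : ∀ {α : Pt m} → InΓ′ α → 1ℚ ≤ head α + last α → InΓ′ (T1 α)
T1-InΓ′ {α = α} g 1≤h+l = ∷-T-tail-InΓ′ _ g
  (≤-by-difference (ℚ.+-mono-≤ (p≤q⇒0≤q-p h≤1) (p≤q⇒0≤q-p l≤1)) (gap₁ (head α) (last α)))
  (≤-by-difference (p≤q⇒0≤q-p 1≤h+l) (gap₂ (head α) (last α)))
  (≤-by-difference (ℚ.+-mono-≤ (p≤q⇒0≤q-p h≤1) (p≤q⇒0≤q-p h≤1)) (gap₃ (head α) (last α)))
  where
  h≤1 = head≤1 g
  l≤1 = ℚ.≤-trans (last≤head α (descending g)) h≤1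
  gap₁ : ∀ h l → (two - h - l) - 0ℚ ≡ (1ℚ - h) + (1ℚ - l)
  gap₁ = solve 2 (λ h l → ((con 1ℚ :+ con 1ℚ) :- h :- l) :- con 0ℚ := (con 1ℚ :- h) :+ (con 1ℚ :- l)) refl
  gap₂ : ∀ h l → 1ℚ - (two - h - l) ≡ (h + l) - 1ℚ
  gap₂ = solve 2 (λ h l → con 1ℚ :- ((con 1ℚ :+ con 1ℚ) :- h :- l) := (h :+ l) :- con 1ℚ) refl
  gap₃ : ∀ h l → (two - h - l) - (h - l) ≡ (1ℚ - h) + (1ℚ - h)
  gap₃ = solve 2 (λ h l → ((con 1ℚ :+ con 1ℚ) :- h :- l) :- (h :- l) := (con 1ℚ :- h) :+ (con 1ℚ :- h)) refl

T-InΓ′ : ∀ {α : Pt m} → InΓ′ α → InΓ′ (T α)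
T-InΓ′ {α = α} g with head α + last α ≤? 1ℚ
... | yes h+l≤1 = T0-InΓ′ g h+l≤1
... | no  h+l≰1 = T1-InΓ′ g (ℚ.<⇒≤ (ℚ.≰⇒> h+l≰1))

iterate-InΓ′ : ∀ i {α : Pt m} → InΓ′ α → InΓ′ (iterate T α i)
iterate-InΓ′ zero    g = g
iterate-InΓ′ (suc i) g = iterate-InΓ′ i (T-InΓ′ g)

-- The tree of iterated preimages of v₀

KStep : Pt m → Pt m → Set
KStep α β = ∃[ k ] ∃[ γ ] (InΓo γ
              × (∃[ δ ] (Tau0 γ δ × Iter Tau1 k δ α))
              × (∃[ ε ] (Tau1 γ ε × Iter Tau0 k ε β)))

KStep-τ₀-τ₁ : ∀ {γ : Pt m} → InΓ′ γ → head γ < 1ℚ → KStep (τ₀ γ) (τ₁ γ)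
KStep-τ₀-τ₁ {γ = γ} g h<1 =
  0 , γ , (InΓ′⇒InΓ g , h<1) , (τ₀ γ , Tau0-τ₀ g , refl) , (τ₁ γ , Tau1-τ₁ g , refl)

KStep-τ₁-τ₀ : ∀ {α β : Pt m} → InΓ′ α → InΓ′ β → KStep α β → KStep (τ₁ α) (τ₀ β)
KStep-τ₁-τ₀ {α = α} {β} gα gβ (k , γ , γ° , (δ , δ₀ , δ→α) , (ε , ε₁ , ε→β)) =
  suc k , γ , γ° , (δ , δ₀ , (α , δ→α , Tau1-τ₁ gα)) , (ε , ε₁ , (β , ε→β , Tau0-τ₀ gβ))

-- For γ₁ = 1 the two preimages τ₀ γ ≡ τ₁ γ coincide and are listed once.
children : Pt m → List (Pt m)
children γ with head γ <? 1ℚ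
... | yes _ = τ₀ γ ∷ τ₁ γ ∷ []
... | no  _ = τ₁ γ ∷ []

head≮1⇒≡1 : ∀ {γ : Pt m} → InΓ′ γ → ¬ (head γ < 1ℚ) → head γ ≡ 1ℚ
head≮1⇒≡1 g h≮1 = ℚ.≤-antisym (head≤1 g) (ℚ.≮⇒≥ h≮1)

children-all : ∀ {p} {P : Pt m → Set p} (γ : Pt m) → P (τ₀ γ) → P (τ₁ γ) → ListAll.All P (children γ)
children-all γ p₀ p₁ with head γ <? 1ℚ
... | yes _ = p₀ ∷ p₁ ∷ []
... | no  _ = p₁ ∷ []

∈-children⁻ : ∀ {α} (γ : Pt m) → α ∈ children γ → α ≡ τ₀ γ ⊎ α ≡ τ₁ γ
∈-children⁻ γ α∈ with head γ <? 1ℚ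
∈-children⁻ γ (here eq)         | yes _ = inj₁ eq
∈-children⁻ γ (there (here eq)) | yes _ = inj₂ eq
∈-children⁻ γ (here eq)         | no  _ = inj₂ eq

τ₀∈children : ∀ {γ : Pt m} → InΓ′ γ → τ₀ γ ∈ children γ
τ₀∈children {γ = γ} g with head γ <? 1ℚ
... | yes _   = here refl
... | no  h≮1 = here (τ₀≡τ₁ γ (head≮1⇒≡1 g h≮1))

τ₁∈children : ∀ (γ : Pt m) → τ₁ γ ∈ children γ
τ₁∈children γ with head γ <? 1ℚ
... | yes _ = there (here refl)
... | no  _ = here refl

children-unique : ∀ {γ : Pt m} → InΓ′ γ → Unique (children γ)
children-unique {γ = γ} g with head γ <? 1ℚ
... | yes h<1 = (τ₀≢τ₁ ∷ []) ∷ [] ∷ []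
  where
  τ₀≢τ₁ : τ₀ γ ≢ τ₁ γ
  τ₀≢τ₁ eq = ℚ.<-irrefl (proj₂ (τ₀≡τ₁⇒ g g eq)) h<1
... | no  _   = [] ∷ []

children-injective : ∀ {α β γ : Pt m} → InΓ′ α → InΓ′ β → γ ∈ children α → γ ∈ children β → α ≡ β
children-injective {α = α} {β} gα gβ γ∈α γ∈β with ∈-children⁻ α γ∈α | ∈-children⁻ β γ∈β
... | inj₁ eq | inj₁ eq′ = τ₀-injective (trans (sym eq) eq′)
... | inj₁ eq | inj₂ eq′ = proj₁ (τ₀≡τ₁⇒ gα gβ (trans (sym eq) eq′))
... | inj₂ eq | inj₁ eq′ = sym (proj₁ (τ₀≡τ₁⇒ gβ gα (trans (sym eq′) eq)))
... | inj₂ eq | inj₂ eq′ = τ₁-injective (trans (sym eq) eq′)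

children-v0 : children (v0 {m}) ≡ v0 ∷ τ₁ v0 ∷ []
children-v0 {m} with head (v0 {m}) <? 1ℚ
... | yes _   = cong (_∷ τ₁ v0 ∷ []) τ₀-v0
... | no  0≮1 = ⊥-elim (0≮1 (ℚ.positive⁻¹ 1ℚ))

children-nonempty : ∀ (γ : Pt m) → ∃[ α ] ∃[ αs ] (children γ ≡ α ∷ αs)
children-nonempty γ with head γ <? 1ℚ
... | yes _ = τ₀ γ , τ₁ γ ∷ [] , refl
... | no  _ = τ₁ γ , [] , refl

∷-children-linked : ∀ {α β : Pt m} {αs} → InΓ′ β → KStep α (τ₀ β) →
                    Linked KStep (children β ++ αs) → Linked KStep (α ∷ children β ++ αs)
∷-children-linked {β = β} g step linked with head β <? 1ℚ
... | yes _   = step ∷ linked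
... | no  h≮1 = subst (KStep _) (τ₀≡τ₁ β (head≮1⇒≡1 g h≮1)) step ∷ linked

concatMap-children-linked : ∀ {αs : List (Pt m)} → ListAll.All InΓ′ αs → Linked KStep αs →
                            Linked KStep (concatMap children αs)
concatMap-children-linked [] [] = []
concatMap-children-linked {αs = α ∷ []} (g ∷ []) [-] with head α <? 1ℚ
... | yes h<1 = KStep-τ₀-τ₁ g h<1 ∷ [-]
... | no  _   = [-]
concatMap-children-linked {αs = α ∷ β ∷ _} (gα ∷ gs@(gβ ∷ _)) (step ∷ linked)
  with head α <? 1ℚ | concatMap-children-linked gs linked
... | yes h<1 | rest = KStep-τ₀-τ₁ gα h<1 ∷ ∷-children-linked gβ (KStep-τ₁-τ₀ gα gβ step) rest
... | no  _   | rest = ∷-children-linked gβ (KStep-τ₁-τ₀ gα gβ step) rest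

concatMap-children-unique : ∀ {αs : List (Pt m)} → ListAll.All InΓ′ αs → Unique αs →
                            Unique (concatMap children αs)
concatMap-children-unique [] [] = []
concatMap-children-unique {αs = α ∷ αs} (g ∷ gs) (α∉αs ∷ unique) =
  Unique.++⁺ (children-unique g) (concatMap-children-unique gs unique) disjoint
  where
  disjoint : ∀ {γ} → γ ∈ children α × γ ∈ concatMap children αs → ⊥
  disjoint (γ∈α , γ∈αs) with find (∈-concatMap⁻ children {xs = αs} γ∈αs)
  ... | β , β∈αs , γ∈β =
    ListAll.lookup α∉αs β∈αs (children-injective g (ListAll.lookup gs β∈αs) γ∈α γ∈β)

-- Since τ₀ v0 = v0, this is the tree spanned from v0 by τ₀ and τ₁ up to depth N, listed breadth first.
upToDepth : ℕ → List (Pt m)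
upToDepth zero    = v0 ∷ []
upToDepth (suc N) = concatMap children (upToDepth N)

upToDepth-all : ∀ {p} {P : Pt m → Set p} → P v0 → (∀ {γ} → P γ → P (τ₀ γ)) → (∀ {γ} → P γ → P (τ₁ γ)) →
                ∀ N → ListAll.All P (upToDepth N)
upToDepth-all p₀ _  _  zero    = p₀ ∷ []
upToDepth-all {P = P} p₀ c₀ c₁ (suc N) =
  ListAll.concat⁺ (ListAll.map⁺ {f = children} (ListAll.map all-children (upToDepth-all p₀ c₀ c₁ N)))
  where
  all-children : ∀ {γ} → P γ → ListAll.All P (children γ)
  all-children {γ} p = children-all γ (c₀ p) (c₁ p)

upToDepth-InΓ′ : ∀ N → ListAll.All InΓ′ (upToDepth {m} N)
upToDepth-InΓ′ = upToDepth-all v0-InΓ′ τ₀-InΓ′ τ₁-InΓ′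

upToDepth-unique : ∀ N → Unique (upToDepth {m} N)
upToDepth-unique zero    = [] ∷ []
upToDepth-unique (suc N) = concatMap-children-unique (upToDepth-InΓ′ N) (upToDepth-unique N)

upToDepth-linked : ∀ N → Linked KStep (upToDepth {m} N)
upToDepth-linked zero    = [-]
upToDepth-linked (suc N) = concatMap-children-linked (upToDepth-InΓ′ N) (upToDepth-linked N)

upToDepth-grows : ∀ N → ∃[ α ] ∃[ αs ] (upToDepth {m} (suc N) ≡ upToDepth N ++ α ∷ αs)
upToDepth-grows zero = τ₁ v0 , [] , cong (_++ []) children-v0
upToDepth-grows (suc N) with upToDepth-grows N
... | α , αs , eq with children-nonempty α
...   | β , βs , eq′ = β , βs ++ concatMap children αs , growth
  where
  open ≡-Reasoning
  growth : upToDepth (suc (suc N)) ≡ upToDepth (suc N) ++ β ∷ βs ++ concatMap children αs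
  growth = begin
    concatMap children (upToDepth (suc N))
      ≡⟨ cong (concatMap children) eq ⟩
    concatMap children (upToDepth N ++ α ∷ αs)
      ≡⟨ concatMap-++ children (upToDepth N) (α ∷ αs) ⟩
    upToDepth (suc N) ++ children α ++ concatMap children αs
      ≡⟨ cong (λ γs → upToDepth (suc N) ++ γs ++ concatMap children αs) eq′ ⟩
    upToDepth (suc N) ++ β ∷ βs ++ concatMap children αs ∎

child∈upToDepth : ∀ {N} {β γ : Pt m} → β ∈ upToDepth N → γ ∈ children β → γ ∈ upToDepth (suc N)
child∈upToDepth β∈ γ∈ = ∈-concatMap⁺ children (lose β∈ γ∈)

reaches-v0⇒∈upToDepth : ∀ N {α : Pt m} → InΓ′ α → iterate T α N ≡ v0 → α ∈ upToDepth N
reaches-v0⇒∈upToDepth zero    _ eq = here eq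
reaches-v0⇒∈upToDepth (suc N) {α} g eq with T-section α | reaches-v0⇒∈upToDepth N (T-InΓ′ g) eq
... | inj₁ α≡τ₀ | Tα∈ = subst (_∈ upToDepth (suc N)) (sym α≡τ₀) (child∈upToDepth {N = N} Tα∈ (τ₀∈children (T-InΓ′ g)))
... | inj₂ α≡τ₁ | Tα∈ = subst (_∈ upToDepth (suc N)) (sym α≡τ₁) (child∈upToDepth {N = N} Tα∈ (τ₁∈children (T α)))

-- Dyadic rationals

abs-cong-* : ∀ a b c d → a ℤ.* b ≡ c ℤ.* d → ∣ a ∣ ℕ.* ∣ b ∣ ≡ ∣ c ∣ ℕ.* ∣ d ∣
abs-cong-* a b c d eq = trans (sym (ℤ.abs-* a b)) (trans (cong ∣_∣ eq) (ℤ.abs-* c d))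

↧ₙ-+-∣ : ∀ p q → ↧ₙ (p + q) ∣ ↧ₙ p ℕ.* ↧ₙ q
↧ₙ-+-∣ p q = subst (↧ₙ (p + q) ∣_) (abs-cong-* (↧ (p + q)) _ (↧ p) (↧ q) (ℚ.↧-+ p q)) (m∣m*n _)

↧ₙ-*-∣ : ∀ p q → ↧ₙ (p * q) ∣ ↧ₙ p ℕ.* ↧ₙ q
↧ₙ-*-∣ p q = subst (↧ₙ (p * q) ∣_) (abs-cong-* (↧ (p * q)) _ (↧ p) (↧ q) (ℚ.↧-* p q)) (m∣m*n _)

↧ₙ-neg : ∀ p → ↧ₙ (- p) ≡ ↧ₙ p
↧ₙ-neg p = cong ∣_∣ (ℚ.↧-neg p)

∣2^⇒≡2^ : ∀ k {d} → d ∣ 2 ^ k → ∃[ j ] (d ≡ 2 ^ j)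
∣2^⇒≡2^ zero    d∣1 = 0 , ∣1⇒≡1 d∣1
∣2^⇒≡2^ (suc k) {d} d∣2^k+1 with 2 ∣? d
... | yes (divides e d≡e*2)
  with ∣2^⇒≡2^ k (*-cancelˡ-∣ {e} 2 (subst (_∣ 2 ^ suc k) (trans d≡e*2 (ℕ.*-comm e 2)) d∣2^k+1))
...   | j , e≡2^j = suc j , trans d≡e*2 (trans (cong (ℕ._* 2) e≡2^j) (ℕ.*-comm (2 ^ j) 2))
∣2^⇒≡2^ (suc k) {d} d∣2^k+1 | no 2∤d = ∣2^⇒≡2^ k (Coprime.coprime-divisor d⊥2 d∣2^k+1)
  where
  d⊥2 : Coprime.Coprime d 2
  d⊥2 (i∣d , i∣2) with irreducible[2] i∣2
  ... | inj₁ i≡1 = i≡1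
  ... | inj₂ refl = ⊥-elim (2∤d i∣d)

dyadic-from-∣ : ∀ r a b → ↧ₙ r ∣ 2 ^ a ℕ.* 2 ^ b → Dyadic r
dyadic-from-∣ r a b r∣ = ∣2^⇒≡2^ (a ℕ.+ b) (subst (↧ₙ r ∣_) (sym (ℕ.^-distribˡ-+-* 2 a b)) r∣)

dyadic-+ : ∀ p q → Dyadic p → Dyadic q → Dyadic (p + q)
dyadic-+ p q (a , p≡) (b , q≡) =
  dyadic-from-∣ (p + q) a b (subst (↧ₙ (p + q) ∣_) (cong₂ ℕ._*_ p≡ q≡) (↧ₙ-+-∣ p q))

dyadic-* : ∀ p q → Dyadic p → Dyadic q → Dyadic (p * q)
dyadic-* p q (a , p≡) (b , q≡) =
  dyadic-from-∣ (p * q) a b (subst (↧ₙ (p * q) ∣_) (cong₂ ℕ._*_ p≡ q≡) (↧ₙ-*-∣ p q))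

dyadic-neg : ∀ p → Dyadic p → Dyadic (- p)
dyadic-neg p (a , p≡) = a , trans (↧ₙ-neg p) p≡

dyadic-- : ∀ p q → Dyadic p → Dyadic q → Dyadic (p - q)
dyadic-- p q dp dq = dyadic-+ p (- q) dp (dyadic-neg q dq)

lift-dyadic : ∀ s {γ : Pt m} → Dyadic s → All Dyadic γ → All Dyadic (lift s γ)
lift-dyadic s {γ = x ∷ v} ds (_ ∷ dv) =
  All.map⁺ (All.map (λ {y} dy → dyadic-+ y (offset s (x ∷ v)) dy doffset) dshift)
  where
  h = head (shift (x ∷ v))
  dshift : All Dyadic (shift (x ∷ v))
  dshift = all-∷ʳ dv (0 , refl)
  doffset : Dyadic (offset s (x ∷ v))
  doffset = dyadic-* ½ (s - h) (1 , refl) (dyadic-- s h ds (all-head dshift))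

τ₀-dyadic : ∀ {γ : Pt m} → All Dyadic γ → All Dyadic (τ₀ γ)
τ₀-dyadic {γ = x ∷ _} ds@(d ∷ _) = lift-dyadic x d ds

τ₁-dyadic : ∀ {γ : Pt m} → All Dyadic γ → All Dyadic (τ₁ γ)
τ₁-dyadic {γ = x ∷ _} ds@(d ∷ _) = lift-dyadic (two - x) (dyadic-- two x (0 , refl) d) ds

v0-dyadic : All Dyadic (v0 {m})
v0-dyadic = All.lookup⁻ (λ i → subst Dyadic (sym (Vec.lookup-replicate i 0ℚ)) (0 , refl))

upToDepth-dyadic : ∀ N → ListAll.All (All Dyadic) (upToDepth {m} N)
upToDepth-dyadic = upToDepth-all v0-dyadic τ₀-dyadic τ₁-dyadic

IsInteger : ℚ → Set
IsInteger q = ↧ₙ q ≡ 1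

isInteger-+ : ∀ p q → IsInteger p → IsInteger q → IsInteger (p + q)
isInteger-+ p q p≡1 q≡1 = ∣1⇒≡1 (subst (↧ₙ (p + q) ∣_) (cong₂ ℕ._*_ p≡1 q≡1) (↧ₙ-+-∣ p q))

isInteger-neg : ∀ p → IsInteger p → IsInteger (- p)
isInteger-neg p p≡1 = trans (↧ₙ-neg p) p≡1

fromℤ : ℤ → ℚ
fromℤ z = mkℚ z 0 (Coprime.sym (Coprime.1-coprimeTo ∣ z ∣))

*-denominator : ∀ q → q * fromℤ (+ ↧ₙ q) ≡ fromℤ (↥ q)
*-denominator q@record{} =
  ℚ.toℚᵘ-injective (ℚᵘ.≃-trans (ℚ.toℚᵘ-homo-* q (fromℤ (+ ↧ₙ q))) (ℚᵘ.*≡* cross))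
  where
  cross : (↥ q ℤ.* + ↧ₙ q) ℤ.* ℤ.1ℤ ≡ ↥ q ℤ.* + (↧ₙ q ℕ.* 1)
  cross = trans (ℤ.*-identityʳ _) (cong (λ n → ↥ q ℤ.* + n) (sym (ℕ.*-identityʳ (↧ₙ q))))

fromℤ-* : ∀ a b → fromℤ (+ (a ℕ.* b)) ≡ fromℤ (+ a) * fromℤ (+ b)
fromℤ-* a b = sym (trans (cong (_/ 1) (sym (ℤ.pos-* a b)))
                         (ℚ.normalize-coprime (Coprime.sym (Coprime.1-coprimeTo (a ℕ.* b)))))

-- Grid k is the additive group 2¹⁻ᵏℤ: Grid 0 = 2ℤ, Grid 1 = ℤ, Grid 2 = ½ℤ, …
Grid : ℕ → ℚ → Set
Grid zero    x = IsInteger (½ * x)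
Grid (suc k) x = Grid k (x + x)

grid-+ : ∀ k x y → Grid k x → Grid k y → Grid k (x + y)
grid-+ zero x y gx gy = subst IsInteger (sym (ℚ.*-distribˡ-+ ½ x y)) (isInteger-+ (½ * x) (½ * y) gx gy)
grid-+ (suc k) x y gx gy = subst (Grid k) (interchange x y) (grid-+ k (x + x) (y + y) gx gy)
  where
  interchange : ∀ x y → (x + x) + (y + y) ≡ (x + y) + (x + y)
  interchange = solve 2 (λ x y → (x :+ x) :+ (y :+ y) := (x :+ y) :+ (x :+ y)) refl

grid-neg : ∀ k x → Grid k x → Grid k (- x)
grid-neg zero x g = subst IsInteger (ℚ.neg-distribʳ-* ½ x) (isInteger-neg (½ * x) g)
grid-neg (suc k) x g = subst (Grid k) (ℚ.neg-distrib-+ x x) (grid-neg k (x + x) g)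

grid-- : ∀ k x y → Grid k x → Grid k y → Grid k (x - y)
grid-- k x y gx gy = grid-+ k x (- y) gx (grid-neg k y gy)

grid-two : ∀ k → Grid k two
grid-two zero    = refl
grid-two (suc k) = grid-+ k two two (grid-two k) (grid-two k)

grid-0ℚ : ∀ k → Grid k 0ℚ
grid-0ℚ zero    = refl
grid-0ℚ (suc k) = grid-0ℚ k

grid-suc : ∀ k x → Grid k x → Grid (suc k) x
grid-suc k x g = grid-+ k x x g g

grid-mono : ∀ {k j} x → k ℕ.≤′ j → Grid k x → Grid j x
grid-mono x ≤′-refl                 g = g
grid-mono x (≤′-step {n = j} k≤j) g = grid-suc j x (grid-mono x k≤j g)

isInteger⇒grid : ∀ k x → IsInteger (x * fromℤ (+ 2 ^ k)) → Grid (suc k) x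
isInteger⇒grid zero    x int = subst IsInteger (halve x) int
  where
  halve : ∀ x → x * 1ℚ ≡ ½ * (x + x)
  halve = solve 1 (λ x → x :* con 1ℚ := con ½ :* (x :+ x)) refl
isInteger⇒grid (suc k) x int = isInteger⇒grid k (x + x) (subst IsInteger scale int)
  where
  double : ∀ x c → x * (two * c) ≡ (x + x) * c
  double = solve 2 (λ x c → x :* ((con 1ℚ :+ con 1ℚ) :* c) := (x :+ x) :* c) refl
  scale : x * fromℤ (+ 2 ^ suc k) ≡ (x + x) * fromℤ (+ 2 ^ k)
  scale = trans (cong (x *_) (fromℤ-* 2 (2 ^ k))) (double x (fromℤ (+ 2 ^ k)))

dyadic⇒grid : ∀ q → Dyadic q → ∃[ k ] Grid k q
dyadic⇒grid q (j , ↧q≡2^j) = suc j , isInteger⇒grid j q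
  (subst (λ d → IsInteger (q * fromℤ (+ d))) ↧q≡2^j (subst IsInteger (sym (*-denominator q)) refl))

isInteger∧0≤∧≤½⇒0 : ∀ y → IsInteger y → 0ℚ ≤ y → y ≤ ½ → y ≡ 0ℚ
isInteger∧0≤∧≤½⇒0 (mkℚ (+ zero)   zero _) refl _        _                  = refl
isInteger∧0≤∧≤½⇒0 (mkℚ +[1+ n ] zero _) refl _        (*≤* (+≤+ (s≤s ())))
isInteger∧0≤∧≤½⇒0 (mkℚ -[1+ n ] zero _) refl (*≤* ()) _

grid₀∧0≤∧≤1⇒0 : ∀ x → Grid 0 x → 0ℚ ≤ x → x ≤ 1ℚ → x ≡ 0ℚ
grid₀∧0≤∧≤1⇒0 x g 0≤x x≤1 = trans (twice-half x) (cong (two *_) half≡0)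
  where
  twice-half : ∀ x → x ≡ two * (½ * x)
  twice-half = solve 1 (λ x → x := (con 1ℚ :+ con 1ℚ) :* (con ½ :* x)) refl
  half≡0 : ½ * x ≡ 0ℚ
  half≡0 = isInteger∧0≤∧≤½⇒0 (½ * x) g (0≤p⇒0≤½*p 0≤x) (ℚ.*-monoˡ-≤-nonNeg ½ x≤1)

-- Descent of dyadic points to v₀

T-tail-grid : ∀ k {α : Pt m} → All (Grid k) α → All (Grid k) (T-tail α)
T-tail-grid k {α} gs = All.map⁺ (All.map (λ {x} g → grid-- k x (last α) g (all-last gs)) (all-init gs))

T-grid : ∀ k {α : Pt m} → All (Grid k) α → All (Grid k) (T α)
T-grid k {α = a ∷ v} gs@(ga ∷ _) with a + last (a ∷ v) ≤? 1ℚ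
... | yes _ = grid-+ k _ _ ga (all-last gs) ∷ T-tail-grid k gs
... | no  _ = grid-- k _ _ (grid-- k _ _ (grid-two k) ga) (all-last gs) ∷ T-tail-grid k gs

iterate-grid : ∀ k i {α : Pt m} → All (Grid k) α → All (Grid k) (iterate T α i)
iterate-grid k zero    gs = gs
iterate-grid k (suc i) gs = iterate-grid k i (T-grid k gs)

module Congruence (k : ℕ) where

  _≋_ : ℚ → ℚ → Set
  x ≋ u = Grid k (x - u)

  Agree : ℚ → ℕ → Vec ℚ n → Set
  Agree u zero    _       = ⊤
  Agree u (suc j) []      = ⊤
  Agree u (suc j) (x ∷ v) = x ≋ u × Agree u j v

  agree-init : ∀ {u} j (v : Vec ℚ (suc n)) → Agree u j v → Agree u j (init v)
  agree-init zero    _           _        = tt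
  agree-init (suc j) (x ∷ [])    _        = tt
  agree-init (suc j) (x ∷ y ∷ v) (p , ps) = p , agree-init j (y ∷ v) ps

  agree-map : ∀ {u u′} j (f : ℚ → ℚ) (v : Vec ℚ n) → (∀ {x} → x ≋ u → f x ≋ u′) →
              Agree u j v → Agree u′ j (map f v)
  agree-map zero    f _       _ _        = tt
  agree-map (suc j) f []      _ _        = tt
  agree-map (suc j) f (x ∷ v) h (p , ps) = h p , agree-map j f v h ps

  agree-all : ∀ {u} (v : Vec ℚ n) → Agree u n v → All (_≋ u) v
  agree-all []      _        = []
  agree-all (x ∷ v) (p , ps) = p ∷ agree-all v ps

  agree-lower : ∀ {u} j (v : Vec ℚ n) → Agree u (suc j) v → Agree u j v
  agree-lower zero    _       _        = tt
  agree-lower (suc j) []      _        = tt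
  agree-lower (suc j) (x ∷ v) (p , ps) = p , agree-lower j v ps

  T-tail-agree : ∀ {u} j {α : Pt m} → Grid (suc k) (last α) → Agree u (suc j) α →
                 Agree (u + last α) (suc j) (T-tail α)
  T-tail-agree {u = u} j {α} gl agree =
    agree-map (suc j) (_- l) (init α) (λ {x} → shift-residue {x}) (agree-init (suc j) α agree)
    where
    l = last α
    regroup : ∀ x u l → (x - u) + - (l + l) ≡ (x - l) - (u + l)
    regroup = solve 3 (λ x u l → (x :- u) :+ (:- (l :+ l)) := (x :- l) :- (u :+ l)) refl
    shift-residue : ∀ {x} → x ≋ u → (x - l) ≋ (u + l)
    shift-residue {x} x≋u = subst (Grid k) (regroup x u l) (grid-+ k (x - u) _ x≋u (grid-neg k (l + l) gl))

  -- Modulo Grid k, both branches of T act as α ↦ (α₁, α₁, α₂, …, αₙ₋₁) + αₙ.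
  T-agree : ∀ {u} j {α : Pt m} → All (Grid (suc k)) α → Grid (suc k) u → Agree u (suc j) α →
            Agree (u + last α) (suc (suc j)) (T α)
  T-agree {u = u} j {α = a ∷ v} gs gu agree@(a≋u , _) with a + last (a ∷ v) ≤? 1ℚ
  ... | yes _ = subst (Grid k) (add-both a u l) a≋u , T-tail-agree j (all-last gs) agree
    where
    l = last (a ∷ v)
    add-both : ∀ a u l → a - u ≡ (a + l) - (u + l)
    add-both = solve 3 (λ a u l → a :- u := (a :+ l) :- (u :+ l)) refl
  ... | no  _ = subst (Grid k) (reflect a u l) reflected≋ , T-tail-agree j (all-last gs) agree
    where
    l = last (a ∷ v)
    reflect : ∀ a u l → two + - (a - u) + - (u + u) + - (l + l) ≡ (two - a - l) - (u + l)
    reflect = solve 3 (λ a u l → (con 1ℚ :+ con 1ℚ) :+ (:- (a :- u)) :+ (:- (u :+ u)) :+ (:- (l :+ l))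
                                 := ((con 1ℚ :+ con 1ℚ) :- a :- l) :- (u :+ l)) refl
    reflected≋ : Grid k (two + - (a - u) + - (u + u) + - (l + l))
    reflected≋ = grid-+ k _ _ (grid-+ k _ _ (grid-+ k _ _ (grid-two k) (grid-neg k _ a≋u))
                   (grid-neg k _ gu)) (grid-neg k _ (all-last gs))

  iterate-agree : ∀ i {j u} {α : Pt m} → All (Grid (suc k)) α → Grid (suc k) u → Agree u (suc j) α →
                  ∃[ u′ ] (Grid (suc k) u′ × Agree u′ (suc (j ℕ.+ i)) (iterate T α i))
  iterate-agree zero {j} gs gu agree =
    _ , gu , subst (λ n → Agree _ (suc n) _) (sym (ℕ.+-identityʳ j)) agree
  iterate-agree (suc i) {j} {u} {α} gs gu agree
    with iterate-agree i (T-grid (suc k) gs) (grid-+ (suc k) u (last α) gu (all-last gs))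
                         (T-agree j gs gu agree)
  ... | u′ , gu′ , agree′ =
    u′ , gu′ , subst (λ n → Agree u′ (suc n) (iterate T (T α) i)) (sym (ℕ.+-suc j i)) agree′

  -- The common residue u + βₙ of the coordinates of T β is ≋ 2u, which lies in Grid k.
  agree⇒T-grid : ∀ {u} {β : Pt m} → All (Grid (suc k)) β → Grid (suc k) u → Agree u (suc m) β →
                 All (Grid k) (T β)
  agree⇒T-grid {m = m} {u} {β} gs gu agree =
    All.map (λ {x} x≋w → subst (Grid k) (cancel x w) (grid-+ k (x - w) w x≋w gw))
      (agree-all (T β) (agree-lower (suc m) (T β) (T-agree m gs gu agree)))
    where
    l = last β
    w = u + l
    cancel : ∀ x w → (x - w) + w ≡ x
    cancel = solve 2 (λ x w → (x :- w) :+ w := x) refl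
    regroup : ∀ u l → (u + u) + (l - u) ≡ u + l
    regroup = solve 2 (λ u l → (u :+ u) :+ (l :- u) := u :+ l) refl
    gw : Grid k w
    gw = subst (Grid k) (regroup u l) (grid-+ k (u + u) (l - u) gu (all-last (agree-all β agree)))

  descend : ∀ {α : Pt m} → All (Grid (suc k)) α → All (Grid k) (iterate T α (m ℕ.+ 1))
  descend {m = m} {α = a ∷ v} gs@(ga ∷ _)
    with iterate-agree m {0} gs ga (subst (Grid k) (sym (ℚ.+-inverseʳ a)) (grid-0ℚ k) , tt)
  ... | u , gu , agree = subst (All (Grid k)) (sym (iterate-+ T (a ∷ v) m 1))
    (agree⇒T-grid (iterate-grid (suc k) m gs) gu agree)

descend-to-grid₀ : ∀ k {α : Pt m} → All (Grid k) α → ∃[ N ] All (Grid 0) (iterate T α N)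
descend-to-grid₀         zero    gs = 0 , gs
descend-to-grid₀ {m = m} (suc k) {α} gs with descend-to-grid₀ k (Congruence.descend k gs)
... | N , gN = m ℕ.+ 1 ℕ.+ N , subst (All (Grid 0)) (sym (iterate-+ T α (m ℕ.+ 1) N)) gN

common-grid : ∀ {v : Vec ℚ n} → All Dyadic v → ∃[ k ] All (Grid k) v
common-grid []       = 0 , []
common-grid {v = x ∷ v} (d ∷ ds) with dyadic⇒grid x d | common-grid ds
... | k , g | K , gs =
  k ℕ.⊔ K ,
  grid-mono x (ℕ.≤⇒≤′ (ℕ.m≤m⊔n k K)) g ∷ All.map (λ {y} → grid-mono y (ℕ.≤⇒≤′ (ℕ.m≤n⊔m k K))) gs

grid₀⇒v0 : ∀ {α : Pt m} → InΓ′ α → All (Grid 0) α → α ≡ v0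
grid₀⇒v0 g gs =
  zeros (All.map (λ { {x} (g₀ , 0≤x , x≤1) → grid₀∧0≤∧≤1⇒0 x g₀ 0≤x x≤1 }) (All.zip (gs , InΓ′-bounded g)))
  where
  zeros : ∀ {n} {v : Vec ℚ n} → All (_≡ 0ℚ) v → v ≡ replicate n 0ℚ
  zeros []         = refl
  zeros (refl ∷ ps) = cong (0ℚ ∷_) (zeros ps)

dyadic⇒reaches-v0 : ∀ {α : Pt m} → InΓ′ α → All Dyadic α → ∃[ N ] (iterate T α N ≡ v0)
dyadic⇒reaches-v0 {α = α} g ds with common-grid ds
... | k , gs with descend-to-grid₀ k gs
...   | N , g₀ = N , grid₀⇒v0 (iterate-InΓ′ N g) g₀

corollary3p7 : ∀ (m : ℕ) →
    Σ (ℕ → Pt m) λ f →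
      (f 0 ≡ v0)
      × (∀ j → KRel (f j) (f (suc j)))
      × (∀ i j → f i ≡ f j → i ≡ j)
      × (∀ j → InΓ (f j) × AllDyadic (f j))
      × (∀ α → InΓ α → AllDyadic α → ∃[ j ] (f j ≡ α))
corollary3p7 m =
  limit , refl , (λ j → inj₂ (limit-linked upToDepth-linked j)) , limit-injective upToDepth-unique ,
  (λ j → InΓ′⇒InΓ (limit-all upToDepth-InΓ′ j) , All.lookup⁺ (limit-all upToDepth-dyadic j)) ,
  onto
  where
  open Limit v0 (upToDepth {m}) (s≤s z≤n) upToDepth-grows
  onto : ∀ α → InΓ α → AllDyadic α → ∃[ j ] (limit j ≡ α)
  onto α αΓ αd with dyadic⇒reaches-v0 (InΓ⇒InΓ′ αΓ) (All.lookup⁻ αd)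
  ... | N , reaches = limit-surjective {N = N} (reaches-v0⇒∈upToDepth N (InΓ⇒InΓ′ αΓ) reaches)
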